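{- Let $G$ be a voltage graph over $\mathbb{Z}_m$ with pinned vertices. Let $H\subseteq G$ consist of a path $P$ of length $p$ from a pinned vertex $x^{*}$ to a non-pinned vertex $v$, and a cycle $C$ of length $q$ containing $v$, where $P$ and $C$ share only the vertex $v$. Suppose that the sum of the voltages along $C$ (traversing $C$ in a fixed direction, with the label of an arc negated when it is traversed against its orientation) is not congruent to $0 \pmod m$. Then $H$ lifts to a cycle of length $2p+q$ in the derived graph $G_m$.
   Context: A voltage graph over $\mathbb{Z}_m$ is a finite directed multigraph whose arcs carry labels in $\mathbb{Z}_m$; an unlabelled edge means label $0$. Some vertices of degree $1$ may be designated pinned vertices. The derived graph $G_m$: each non-pinned vertex $v$ gives vertices $v^0,\dots,v^{m-1}$; each pinned vertex $v^{*}$ gives a single vertex $v^{*}$; an arc from non-pinned $v$ to non-pinned $w$ labelled $a$ gives edges $v^iw^{i+a}$ for all $i$ (indices mod $m$); an edge between pinned $v^{*}$ and non-pinned $w$ gives edges $v^{*}w^i$ for all $i$. -}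

module Defs where

open import Data.Nat as ℕ using (ℕ; zero; suc; NonZero)
open import Data.Nat.DivMod using (_%_; m%n<n)
open import Data.Fin using (Fin; toℕ; fromℕ<; inject₁) renaming (zero to fzero; suc to fsuc)
open import Data.Integer as ℤ using (ℤ; +_; -_)
open import Data.Integer.DivMod using (_%ℕ_; n%ℕd<d)
open import Data.Bool using (Bool; true; false; if_then_else_)
open import Data.Product using (Σ; _×_; _,_; proj₁; proj₂; ∃)
open import Data.Sum using (_⊎_)
open import Relation.Binary.PropositionalEquality using (_≡_; _≢_)
open import Function.Definitions using (Injective)

-- Generic walks in a finite multigraph whose edges have two ends
-- (src, tgt); an edge may be traversed along (true) or against (false)
-- its orientation.

module _ {V E : Set} (src tgt : E → V) where

  Step : Set
  Step = E × Bool

  start : Step → V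
  start (e , true)  = src e
  start (e , false) = tgt e

  end : Step → V
  end (e , true)  = tgt e
  end (e , false) = src e

  next : ∀ {L} → Fin L → Fin L
  next {suc L} i = fromℕ< (m%n<n (suc (toℕ i)) (suc L))

  record Path (p : ℕ) : Set where
    field
      vert     : Fin (suc p) → V
      step     : Fin p → Step
      step-src : ∀ j → start (step j) ≡ vert (inject₁ j)
      step-tgt : ∀ j → end (step j) ≡ vert (fsuc j)
      vert-inj : Injective _≡_ _≡_ vert

  record Cycle (L : ℕ) : Set where
    field
      len-pos  : NonZero L
      vert     : Fin L → V
      step     : Fin L → Step
      step-src : ∀ j → start (step j) ≡ vert j
      step-tgt : ∀ j → end (step j) ≡ vert (next j)
      vert-inj : Injective _≡_ _≡_ vert
      edge-inj : Injective _≡_ _≡_ (λ j → proj₁ (step j))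

-- Voltage graphs over ℤ_m (labels are integer representatives).

Degree1 : ∀ {nV nA} → (tail head : Fin nA → Fin nV) → Fin nV → Set
Degree1 {nV} {nA} tail head v =
  Σ (Fin nA) λ a → (tail a ≡ v ⊎ head a ≡ v) × (tail a ≢ head a)
    × (∀ b → (tail b ≡ v ⊎ head b ≡ v) → b ≡ a)

record VoltageGraph : Set where
  field
    nV nA  : ℕ
    tail   : Fin nA → Fin nV
    head   : Fin nA → Fin nV
    label  : Fin nA → ℤ
    pinned : Fin nV → Bool
    pinned-deg1 : ∀ v → pinned v ≡ true → Degree1 tail head v

module _ (G : VoltageGraph) where
  open VoltageGraph G

  stepVoltage : Step tail head → ℤ
  stepVoltage (a , true)  = label a
  stepVoltage (a , false) = - label a

sumℤ : ∀ {n} → (Fin n → ℤ) → ℤ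
sumℤ {zero}  f = + 0
sumℤ {suc n} f = f fzero ℤ.+ sumℤ (λ j → f (fsuc j))

module Derived (G : VoltageGraph) (m : ℕ) .{{_ : NonZero m}} where
  open VoltageGraph G

  data DVert : Set where
    pin  : Fin nV → DVert           -- v* (used only for pinned v)
    copy : Fin nV → Fin m → DVert   -- v^i (used only for non-pinned v)

  shift : Fin m → ℤ → Fin m
  shift i a = fromℕ< (n%ℕd<d ((+ toℕ i) ℤ.+ a) m)

  liftV : Fin nV → Fin m → DVert
  liftV v i = if pinned v then pin v else copy v i

  DEdge : Set
  DEdge = Fin nA × Fin m

  dsrc : DEdge → DVert
  dsrc (a , i) = liftV (tail a) i

  dtgt : DEdge → DVert
  dtgt (a , i) = liftV (head a) (shift i (label a))

  proj : DEdge → Fin nA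
  proj (a , i) = a

cycleVoltage : (G : VoltageGraph) → ∀ {q} →
  Cycle (VoltageGraph.tail G) (VoltageGraph.head G) q → ℤ
cycleVoltage G C = sumℤ (λ j → stepVoltage G (Cycle.step C j))

InH : (G : VoltageGraph) → ∀ {p q} →
  Path (VoltageGraph.tail G) (VoltageGraph.head G) p →
  Cycle (VoltageGraph.tail G) (VoltageGraph.head G) q →
  Fin (VoltageGraph.nA G) → Set
InH G P C a = (∃ λ j → proj₁ (Path.step P j) ≡ a) ⊎ (∃ λ j → proj₁ (Cycle.step C j) ≡ a)

LiftsTo : (G : VoltageGraph) (m : ℕ) .{{_ : NonZero m}} → ∀ {p q L} →
  (P : Path (VoltageGraph.tail G) (VoltageGraph.head G) p) →
  (C : Cycle (VoltageGraph.tail G) (VoltageGraph.head G) q) →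
  Cycle (Derived.dsrc G m) (Derived.dtgt G m) L → Set
LiftsTo G m P C D =
  (∀ j → InH G P C (Derived.proj G m (proj₁ (Cycle.step D j))))
  × (∀ a → InH G P C a → ∃ λ j → Derived.proj G m (proj₁ (Cycle.step D j)) ≡ a)

-- Walk from x* along P to v, once around C, and back along P to x*: a closed walk of length 2p + q
-- in G. Lift it to G_m step by step, taking as level at each time the integer sum of the voltages
-- traversed so far. Only the arcs of P and the vertices of P other than x* are met twice, once on
-- the way out and once on the way back, and at the second visit the level exceeds the first by
-- exactly the voltage α of C. As m ∤ α the two visits lie in different copies; for vertices this
-- uses that they are not pinned, which holds since a pinned vertex has degree 1 and so is not
-- interior to P. As x* is pinned, the lifted walk closes up into a cycle of length 2p + q over H.
module Submission where

open import Defs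
open import Data.Nat using (ℕ; NonZero; _+_; _*_)
open import Data.Fin using (Fin; fromℕ)
open import Data.Bool using (true; false)
open import Data.Integer using (+_)
open import Data.Integer.Divisibility using (_∣_)
open import Data.Product using (Σ; _×_; ∃)
open import Relation.Binary.PropositionalEquality using (_≡_)
open import Relation.Nullary using (¬_)

open import Data.Nat as ℕ using (zero; suc; _∸_; _<_; _≤_; z≤n; s≤s)
import Data.Nat.Properties as ℕ
import Data.Nat.Divisibility as ℕ
open import Data.Nat.DivMod using (_%_; m%n<n; m<n⇒m%n≡m; n%n≡0)
open import Data.Fin as Fin using (toℕ; fromℕ<)
import Data.Fin.Properties as Fin
open import Data.Integer as ℤ using (ℤ; 0ℤ; -_; _-_)
import Data.Integer.Properties as ℤ
open import Data.Integer.DivMod using (_%ℕ_; _/ℕ_; n%ℕd<d; a≡a%ℕn+[a/ℕn]*n)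
open import Data.Integer.Divisibility.Signed
  using (divides; ∣⇒∣ᵤ; ∣m∣n⇒∣m+n; ∣m∣n⇒∣m-n) renaming (_∣_ to _∣ℤ_)
open import Data.Integer.Tactic.RingSolver using (solve-∀)
open import Data.Nat.Tactic.RingSolver using () renaming (solve-∀ to ℕ-solve-∀)
open import Algebra.Properties.AbelianGroup ℤ.+-0-abelianGroup using () renaming (∙-cancelˡ to +-cancelˡ)
open import Data.Bool using (Bool; not)
open import Data.Product using (_,_; proj₁; proj₂)
open import Data.Sum using (_⊎_; inj₁; inj₂)
open import Relation.Binary.PropositionalEquality
  using (_≢_; refl; sym; trans; cong; cong₂; subst; module ≡-Reasoning)
open import Relation.Nullary using (contradiction; yes; no)
open import Data.Empty using (⊥-elim)
open import Function using (_∘_)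

n<d⇒d∣n⇒n≡0 : ∀ {d n} → n < d → d ℕ.∣ n → n ≡ 0
n<d⇒d∣n⇒n≡0 {n = zero}  _   _   = refl
n<d⇒d∣n⇒n≡0 {n = suc _} n<d d∣n = contradiction d∣n (ℕ.>⇒∤ n<d)

n≤o∸m⇒m+n≤o : ∀ {m n o} → m ≤ o → n ≤ o ∸ m → m + n ≤ o
n≤o∸m⇒m+n≤o {m} m≤o n≤o∸m = subst (m + _ ≤_) (ℕ.m+[n∸m]≡n m≤o) (ℕ.+-monoʳ-≤ m n≤o∸m)

module _ (m : ℕ) .{{_ : NonZero m}} where

  reduce : ℤ → Fin m
  reduce z = fromℕ< (n%ℕd<d z m)

  remainder-unique : ∀ {r s} → r < m → s < m → + m ∣ℤ + r - + s → r ≡ s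
  remainder-unique {r} {s} r<m s<m m∣r-s =
    ℤ.+-injective (ℤ.i-j≡0⇒i≡j (+ r) (+ s) (ℤ.∣i∣≡0⇒i≡0 (n<d⇒d∣n⇒n≡0 ∣r-s∣<m (∣⇒∣ᵤ m∣r-s))))
    where
    ∣r-s∣<m : ℤ.∣ + r - + s ∣ < m
    ∣r-s∣<m = ℕ.≤-<-trans (ℕ.≤-reflexive (cong ℤ.∣_∣ (ℤ.[+m]-[+n]≡m⊖n r s)))
                (ℕ.≤-<-trans (ℤ.∣m⊝n∣≤m⊔n r s) (ℕ.⊔-lub r<m s<m))

  reduce-sound : ∀ z → + m ∣ℤ + toℕ (reduce z) - z
  reduce-sound z = subst (λ r → + m ∣ℤ + r - z) (sym (Fin.toℕ-fromℕ< (n%ℕd<d z m)))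
    (divides (- (z /ℕ m)) (begin
      + (z %ℕ m) - z                                      ≡⟨ cong (λ w → + (z %ℕ m) - w) (a≡a%ℕn+[a/ℕn]*n z m) ⟩
      + (z %ℕ m) - (+ (z %ℕ m) ℤ.+ z /ℕ m ℤ.* + m)         ≡⟨ lemma (+ (z %ℕ m)) (z /ℕ m) (+ m) ⟩
      - (z /ℕ m) ℤ.* + m                                  ∎))
    where
    open ≡-Reasoning
    lemma : ∀ r d m → r - (r ℤ.+ d ℤ.* m) ≡ - d ℤ.* m
    lemma = solve-∀

  reduce-cong : ∀ {a b} → + m ∣ℤ a - b → reduce a ≡ reduce b
  reduce-cong {a} {b} m∣a-b = Fin.toℕ-injective (remainder-unique (Fin.toℕ<n _) (Fin.toℕ<n _)
    (subst (+ m ∣ℤ_) (lemma a b (+ toℕ (reduce a)) (+ toℕ (reduce b)))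
      (∣m∣n⇒∣m-n (∣m∣n⇒∣m+n (reduce-sound a) m∣a-b) (reduce-sound b))))
    where
    lemma : ∀ a b r s → (r - a ℤ.+ (a - b)) - (s - b) ≡ r - s
    lemma = solve-∀

  reduce-injective : ∀ {a b} → reduce a ≡ reduce b → + m ∣ℤ a - b
  reduce-injective {a} {b} eq = subst (+ m ∣ℤ_) (lemma a b (+ toℕ (reduce b)))
    (∣m∣n⇒∣m-n (reduce-sound b) (subst (λ r → + m ∣ℤ + toℕ r - a) eq (reduce-sound a)))
    where
    lemma : ∀ a b r → (r - b) - (r - a) ≡ a - b
    lemma = solve-∀

  reduce-toℕ : ∀ i → reduce (+ toℕ i) ≡ i
  reduce-toℕ i = Fin.toℕ-injective (trans (Fin.toℕ-fromℕ< _) (m<n⇒m%n≡m (Fin.toℕ<n i)))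

  reduce-+-modulus : ∀ z → reduce (z ℤ.+ + m) ≡ reduce z
  reduce-+-modulus z = reduce-cong {z ℤ.+ + m} {z} (divides (+ 1) (lemma z (+ m)))
    where
    lemma : ∀ z m → (z ℤ.+ m) - z ≡ + 1 ℤ.* m
    lemma = solve-∀

sumUpTo : (ℕ → ℤ) → ℕ → ℤ
sumUpTo f zero    = 0ℤ
sumUpTo f (suc n) = sumUpTo f n ℤ.+ f n

sumUpTo-cong : ∀ {f g} n → (∀ i → i < n → f i ≡ g i) → sumUpTo f n ≡ sumUpTo g n
sumUpTo-cong zero    f≗g = refl
sumUpTo-cong (suc n) f≗g =
  cong₂ ℤ._+_ (sumUpTo-cong n (λ i i<n → f≗g i (ℕ.m<n⇒m<1+n i<n))) (f≗g n ℕ.≤-refl)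

sumUpTo-suc : ∀ f n → sumUpTo f (suc n) ≡ f 0 ℤ.+ sumUpTo (λ i → f (suc i)) n
sumUpTo-suc f zero    = trans (ℤ.+-identityˡ (f 0)) (sym (ℤ.+-identityʳ (f 0)))
sumUpTo-suc f (suc n) = trans (cong (ℤ._+ f (suc n)) (sumUpTo-suc f n))
  (ℤ.+-assoc (f 0) (sumUpTo (λ i → f (suc i)) n) (f (suc n)))

sumUpTo-toℕ : ∀ n {g : ℕ → ℤ} {f : Fin n → ℤ} → (∀ j → g (toℕ j) ≡ f j) → sumUpTo g n ≡ sumℤ f
sumUpTo-toℕ zero    g≗f = refl
sumUpTo-toℕ (suc n) g≗f = trans (sumUpTo-suc _ n)
  (cong₂ ℤ._+_ (g≗f Fin.zero) (sumUpTo-toℕ n (λ j → g≗f (Fin.suc j))))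

sumUpTo-periodic-shift : ∀ n (g : ℕ → ℤ) → (∀ i → g (i + n) ≡ g i) →
  ∀ k → sumUpTo (λ i → g (k + i)) n ≡ sumUpTo g n
sumUpTo-periodic-shift n g periodic zero    = refl
sumUpTo-periodic-shift n g periodic (suc k) = trans shift-by-one (sumUpTo-periodic-shift n g periodic k)
  where
  open ≡-Reasoning
  h : ℕ → ℤ
  h i = g (k + i)
  k+1+i≡k+[1+i] : ∀ i → suc k + i ≡ k + suc i
  k+1+i≡k+[1+i] i = sym (ℕ.+-suc k i)
  h-periodic : h n ≡ h 0
  h-periodic = trans (periodic k) (cong g (sym (ℕ.+-identityʳ k)))
  shift-by-one : sumUpTo (λ i → g (suc k + i)) n ≡ sumUpTo h n
  shift-by-one = +-cancelˡ (h 0) _ _ (begin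
    h 0 ℤ.+ sumUpTo (λ i → g (suc k + i)) n ≡⟨ cong (λ w → h 0 ℤ.+ w) (sumUpTo-cong n (λ i _ → cong g (k+1+i≡k+[1+i] i))) ⟩
    h 0 ℤ.+ sumUpTo (λ i → h (suc i)) n     ≡⟨ sumUpTo-suc h n ⟨
    sumUpTo h n ℤ.+ h n                     ≡⟨ cong (λ w → sumUpTo h n ℤ.+ w) h-periodic ⟩
    sumUpTo h n ℤ.+ h 0                     ≡⟨ ℤ.+-comm (sumUpTo h n) (h 0) ⟩
    h 0 ℤ.+ sumUpTo h n                     ∎)

module _ {n : ℕ} (k : Fin (suc n)) where

  rotate : ℕ → Fin (suc n)
  rotate u = reduce (suc n) (+ (toℕ k + u))

  rotate-zero : rotate 0 ≡ k
  rotate-zero = trans (cong (λ i → reduce (suc n) (+ i)) (ℕ.+-identityʳ (toℕ k))) (reduce-toℕ (suc n) k)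

  rotate-period : rotate (suc n) ≡ k
  rotate-period = trans (reduce-+-modulus (suc n) (+ toℕ k)) (reduce-toℕ (suc n) k)

  next-rotate : ∀ {V E : Set} (src tgt : E → V) u → next src tgt (rotate u) ≡ rotate (suc u)
  next-rotate src tgt u = reduce-cong (suc n) {+ suc (toℕ (rotate u))} {+ (toℕ k + suc u)}
    (subst (+ suc n ∣ℤ_) (lemma (+ 1) (+ toℕ (rotate u)) (+ toℕ k) (+ u)) (reduce-sound (suc n) (+ (toℕ k + u))))
    where
    lemma : ∀ c r k u → r - (k ℤ.+ u) ≡ (c ℤ.+ r) - (k ℤ.+ (c ℤ.+ u))
    lemma = solve-∀

  rotate-injective : ∀ {u u'} → u < suc n → u' < suc n → rotate u ≡ rotate u' → u ≡ u'
  rotate-injective {u} {u'} u<q u'<q eq = remainder-unique (suc n) u<q u'<q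
    (subst (+ suc n ∣ℤ_) (lemma (+ toℕ k) (+ u) (+ u'))
      (reduce-injective (suc n) {+ (toℕ k + u)} {+ (toℕ k + u')} eq))
    where
    lemma : ∀ k u u' → (k ℤ.+ u) - (k ℤ.+ u') ≡ u - u'
    lemma = solve-∀

  rotate-surjective : ∀ j → Σ ℕ λ u → u < suc n × rotate u ≡ j
  rotate-surjective j = toℕ r , Fin.toℕ<n r ,
    trans (reduce-cong (suc n) {+ (toℕ k + toℕ r)} {+ toℕ j} k+r≡j) (reduce-toℕ (suc n) j)
    where
    r = reduce (suc n) (+ toℕ j - + toℕ k)
    lemma : ∀ k r j → r - (j - k) ≡ (k ℤ.+ r) - j
    lemma = solve-∀
    k+r≡j : + suc n ∣ℤ + (toℕ k + toℕ r) - + toℕ j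
    k+r≡j = subst (+ suc n ∣ℤ_) (lemma (+ toℕ k) (+ toℕ r) (+ toℕ j)) (reduce-sound (suc n) (+ toℕ j - + toℕ k))

  sumUpTo-rotate : ∀ (f : Fin (suc n) → ℤ) → sumUpTo (λ u → f (rotate u)) (suc n) ≡ sumℤ f
  sumUpTo-rotate f = trans (sumUpTo-periodic-shift (suc n) g g-periodic (toℕ k))
    (sumUpTo-toℕ (suc n) (λ j → cong f (reduce-toℕ (suc n) j)))
    where
    g : ℕ → ℤ
    g i = f (reduce (suc n) (+ i))
    g-periodic : ∀ i → g (i + suc n) ≡ g i
    g-periodic i = cong f (reduce-+-modulus (suc n) (+ i))

reverse : ∀ {E : Set} → E × Bool → E × Bool
reverse (e , b) = e , not b

module _ {V E : Set} (src tgt : E → V) where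

  start-reverse : ∀ s → start src tgt (reverse s) ≡ end src tgt s
  start-reverse (e , true)  = refl
  start-reverse (e , false) = refl

  end-reverse : ∀ s → end src tgt (reverse s) ≡ start src tgt s
  end-reverse (e , true)  = refl
  end-reverse (e , false) = refl

  start-incident : ∀ s {w} → start src tgt s ≡ w → src (proj₁ s) ≡ w ⊎ tgt (proj₁ s) ≡ w
  start-incident (e , true)  eq = inj₁ eq
  start-incident (e , false) eq = inj₂ eq

  end-incident : ∀ s {w} → end src tgt s ≡ w → src (proj₁ s) ≡ w ⊎ tgt (proj₁ s) ≡ w
  end-incident (e , true)  eq = inj₂ eq
  end-incident (e , false) eq = inj₁ eq

  same-edge-ends : ∀ s s' → proj₁ s ≡ proj₁ s' →
    (start src tgt s ≡ start src tgt s' × end src tgt s ≡ end src tgt s')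
    ⊎ (start src tgt s ≡ end src tgt s' × end src tgt s ≡ start src tgt s')
  same-edge-ends (e , true)  (.e , true)  refl = inj₁ (refl , refl)
  same-edge-ends (e , true)  (.e , false) refl = inj₂ (refl , refl)
  same-edge-ends (e , false) (.e , true)  refl = inj₂ (refl , refl)
  same-edge-ends (e , false) (.e , false) refl = inj₁ (refl , refl)

clamp : (n : ℕ) → ℕ → Fin (suc n)
clamp n s = fromℕ< (s≤s (ℕ.m⊓n≤n s n))

toℕ-clamp : ∀ {n s} → s ≤ n → toℕ (clamp n s) ≡ s
toℕ-clamp {n} {s} s≤n = trans (Fin.toℕ-fromℕ< _) (ℕ.m≤n⇒m⊓n≡m s≤n)

clamp-unique : ∀ {n s} {j : Fin (suc n)} → s ≤ n → toℕ j ≡ s → clamp n s ≡ j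
clamp-unique s≤n eq = Fin.toℕ-injective (trans (toℕ-clamp s≤n) (sym eq))

module PathAt {V E : Set} {src tgt : E → V} {n : ℕ} (P : Path src tgt (suc n)) where
  open Path P

  vertexAt : ℕ → V
  vertexAt s = vert (clamp (suc n) s)

  stepAt : ℕ → E × Bool
  stepAt s = step (clamp n s)

  start-stepAt : ∀ {s} → s < suc n → start src tgt (stepAt s) ≡ vertexAt s
  start-stepAt {s} s<p = trans (step-src _)
    (cong vert (sym (clamp-unique (ℕ.<⇒≤ s<p) (trans (Fin.toℕ-inject₁ _) (toℕ-clamp (ℕ.s≤s⁻¹ s<p))))))

  end-stepAt : ∀ {s} → s < suc n → end src tgt (stepAt s) ≡ vertexAt (suc s)
  end-stepAt {s} s<p = trans (step-tgt _)
    (cong vert (sym (clamp-unique s<p (cong suc (toℕ-clamp (ℕ.s≤s⁻¹ s<p))))))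

  vertexAt-injective : ∀ {s s'} → s ≤ suc n → s' ≤ suc n → vertexAt s ≡ vertexAt s' → s ≡ s'
  vertexAt-injective s≤p s'≤p eq =
    trans (sym (toℕ-clamp s≤p)) (trans (cong toℕ (vert-inj eq)) (toℕ-clamp s'≤p))

  stepAt-injective : ∀ {s s'} → s < suc n → s' < suc n → proj₁ (stepAt s) ≡ proj₁ (stepAt s') → s ≡ s'
  stepAt-injective {s} {s'} s<p s'<p eq with same-edge-ends src tgt (stepAt s) (stepAt s') eq
  ... | inj₁ (starts , _) = vertexAt-injective (ℕ.<⇒≤ s<p) (ℕ.<⇒≤ s'<p)
          (trans (sym (start-stepAt s<p)) (trans starts (start-stepAt s'<p)))
  ... | inj₂ (start≡end , end≡start) =
    contradiction (ℕ.≤-reflexive 1+s≡s') (ℕ.<-asym (ℕ.≤-reflexive (sym s≡1+s')))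
    where
    s≡1+s' : s ≡ suc s'
    s≡1+s' = vertexAt-injective (ℕ.<⇒≤ s<p) s'<p (trans (sym (start-stepAt s<p)) (trans start≡end (end-stepAt s'<p)))
    1+s≡s' : suc s ≡ s'
    1+s≡s' = vertexAt-injective s<p (ℕ.<⇒≤ s'<p) (trans (sym (end-stepAt s<p)) (trans end≡start (start-stepAt s'<p)))

module _ (G : VoltageGraph) where
  open VoltageGraph G

  stepVoltage-reverse : ∀ s → stepVoltage G (reverse s) ≡ - stepVoltage G s
  stepVoltage-reverse (a , true)  = refl
  stepVoltage-reverse (a , false) = sym (ℤ.neg-involutive (label a))

  module _ {n} (P : Path tail head (suc n)) where
    open PathAt P

    -- A pinned vertex has degree 1, but an interior vertex of a path meets two distinct arcs.
    path-interior-unpinned : ∀ {s} → 0 < s → s < suc n → pinned (vertexAt s) ≡ false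
    path-interior-unpinned {suc s} 0<s s<p with pinned (vertexAt (suc s)) in eq
    ... | false = refl
    ... | true with pinned-deg1 _ eq
    ...   | a , _ , _ , only-a =
      contradiction (stepAt-injective s<p′ s<p (trans into (sym out-of))) (ℕ.1+n≢n ∘ sym)
      where
      s<p′ : s < suc n
      s<p′ = ℕ.m<n⇒m<1+n (ℕ.s<s⁻¹ s<p)
      into : proj₁ (stepAt s) ≡ a
      into = only-a _ (end-incident tail head (stepAt s) (end-stepAt s<p′))
      out-of : proj₁ (stepAt (suc s)) ≡ a
      out-of = only-a _ (start-incident tail head (stepAt (suc s)) (start-stepAt s<p))

module Lift (G : VoltageGraph) (m : ℕ) .{{_ : NonZero m}} where
  open VoltageGraph G
  open Derived G m

  shift-reduce : ∀ z a → shift (reduce m z) a ≡ reduce m (z ℤ.+ a)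
  shift-reduce z a = reduce-cong m {+ toℕ (reduce m z) ℤ.+ a} {z ℤ.+ a}
    (subst (+ m ∣ℤ_) (lemma (+ toℕ (reduce m z)) z a) (reduce-sound m z))
    where
    lemma : ∀ r z a → r - z ≡ (r ℤ.+ a) - (z ℤ.+ a)
    lemma = solve-∀

  shift-reduce-cancel : ∀ z a → shift (reduce m (z - a)) a ≡ reduce m z
  shift-reduce-cancel z a = trans (shift-reduce (z - a) a) (cong (reduce m) (lemma z a))
    where
    lemma : ∀ z a → z - a ℤ.+ a ≡ z
    lemma = solve-∀

  -- Levels are integers, reduced mod m only in G_m; traversing an arc a backwards from level z
  -- uses the copy of a whose tail lies at level z - label a.
  liftStep : ℤ → Step tail head → Step dsrc dtgt
  liftStep z (a , true)  = (a , reduce m z) , true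
  liftStep z (a , false) = (a , reduce m (z - label a)) , false

  start-liftStep : ∀ z s → start dsrc dtgt (liftStep z s) ≡ liftV (start tail head s) (reduce m z)
  start-liftStep z (a , true)  = refl
  start-liftStep z (a , false) = cong (liftV (head a)) (shift-reduce-cancel z (label a))

  end-liftStep : ∀ z s → end dsrc dtgt (liftStep z s) ≡ liftV (end tail head s) (reduce m (z ℤ.+ stepVoltage G s))
  end-liftStep z (a , true)  = cong (liftV (head a)) (shift-reduce z (label a))
  end-liftStep z (a , false) = refl

  proj-liftStep : ∀ z s → proj (proj₁ (liftStep z s)) ≡ proj₁ s
  proj-liftStep z (a , true)  = refl
  proj-liftStep z (a , false) = refl

  liftStep-reverse : ∀ z z' s → proj₁ (liftStep z s) ≡ proj₁ (liftStep z' (reverse s)) →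
    reduce m (z ℤ.+ stepVoltage G s) ≡ reduce m z'
  liftStep-reverse z z' (a , true)  eq = begin
    reduce m (z ℤ.+ label a)                   ≡⟨ shift-reduce z (label a) ⟨
    shift (reduce m z) (label a)               ≡⟨ cong (λ i → shift i (label a)) (cong proj₂ eq) ⟩
    shift (reduce m (z' - label a)) (label a)  ≡⟨ shift-reduce-cancel z' (label a) ⟩
    reduce m z'                                ∎
    where open ≡-Reasoning
  liftStep-reverse z z' (a , false) eq = cong proj₂ eq

  liftV-pinned : ∀ {w i} → pinned w ≡ true → liftV w i ≡ pin w
  liftV-pinned pinned-w rewrite pinned-w = refl

  liftV-unpinned : ∀ {w i} → pinned w ≡ false → liftV w i ≡ copy w i
  liftV-unpinned unpinned-w rewrite unpinned-w = refl

  liftV-injectiveˡ : ∀ {w w' i i'} → liftV w i ≡ liftV w' i' → w ≡ w'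
  liftV-injectiveˡ {w} {w'} {i} {i'} eq = trans (sym (base-liftV w i)) (trans (cong base eq) (base-liftV w' i'))
    where
    base : DVert → Fin nV
    base (pin u)    = u
    base (copy u _) = u
    base-liftV : ∀ u j → base (liftV u j) ≡ u
    base-liftV u j with pinned u
    ... | true  = refl
    ... | false = refl

  liftV-injectiveʳ : ∀ {w i i'} → pinned w ≡ false → liftV w i ≡ liftV w i' → i ≡ i'
  liftV-injectiveʳ unpinned-w eq with trans (sym (liftV-unpinned unpinned-w)) (trans eq (liftV-unpinned unpinned-w))
  ... | refl = refl

module LiftedCycle (G : VoltageGraph) (m : ℕ) .{{_ : NonZero m}} (p₀ q₀ : ℕ)
  {x v : Fin (VoltageGraph.nV G)}
  (pinned-x : VoltageGraph.pinned G x ≡ true) (unpinned-v : VoltageGraph.pinned G v ≡ false)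
  (P : Path (VoltageGraph.tail G) (VoltageGraph.head G) (suc p₀))
  (P-start : Path.vert P Fin.zero ≡ x) (P-end : Path.vert P (fromℕ (suc p₀)) ≡ v)
  (C : Cycle (VoltageGraph.tail G) (VoltageGraph.head G) (suc q₀))
  (k : Fin (suc q₀)) (C-k : Cycle.vert C k ≡ v)
  (P∩C⊆v : ∀ j k → Path.vert P j ≡ Cycle.vert C k → Path.vert P j ≡ v)
  (m∤α : ¬ (+ m ∣ cycleVoltage G C)) where

  open VoltageGraph G
  open Derived G m
  open Lift G m
  open PathAt P

  p q L : ℕ
  p = suc p₀
  q = suc q₀
  L = p + q + p

  stepStart stepEnd : Step tail head → Fin nV
  stepStart = start tail head
  stepEnd   = end tail head

  vertexAt-p : vertexAt p ≡ v
  vertexAt-p = trans (cong (Path.vert P) (clamp-unique ℕ.≤-refl (Fin.toℕ-fromℕ p))) P-end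

  vertexAt≡v : ∀ {s} → s ≤ p → vertexAt s ≡ v → s ≡ p
  vertexAt≡v s≤p eq = vertexAt-injective s≤p ℕ.≤-refl (trans eq (sym vertexAt-p))

  cycleVertexAt : ℕ → Fin nV
  cycleVertexAt u = Cycle.vert C (rotate k u)

  cycleStepAt : ℕ → Step tail head
  cycleStepAt u = Cycle.step C (rotate k u)

  start-cycleStepAt : ∀ u → stepStart (cycleStepAt u) ≡ cycleVertexAt u
  start-cycleStepAt u = Cycle.step-src C (rotate k u)

  end-cycleStepAt : ∀ u → stepEnd (cycleStepAt u) ≡ cycleVertexAt (suc u)
  end-cycleStepAt u = trans (Cycle.step-tgt C (rotate k u)) (cong (Cycle.vert C) (next-rotate k tail head u))

  cycleVertexAt≡v : ∀ {u} → u < q → cycleVertexAt u ≡ v → u ≡ 0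
  cycleVertexAt≡v u<q eq = rotate-injective k u<q (s≤s z≤n)
    (Cycle.vert-inj C (trans eq (trans (sym C-k) (cong (Cycle.vert C) (sym (rotate-zero k))))))

  path-avoids-cycle : ∀ {s} u → s < p → vertexAt s ≢ cycleVertexAt u
  path-avoids-cycle u s<p eq = ℕ.<⇒≢ s<p (vertexAt≡v (ℕ.<⇒≤ s<p) (P∩C⊆v _ (rotate k u) eq))

  data Position (t : ℕ) : Set where
    along  : ∀ s → s < p → t ≡ s → Position t
    around : ∀ u → u < q → t ≡ p + u → Position t
    back   : ∀ u → u < p → t ≡ p + q + u → Position t
    beyond : L ≤ t → Position t

  position : ∀ t → Position t
  position t with t ℕ.<? p | t ∸ p ℕ.<? q | t ∸ (p + q) ℕ.<? p
  ... | yes t<p | _       | _       = along t t<p refl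
  ... | no t≮p  | yes u<q | _       = around (t ∸ p) u<q (sym (ℕ.m+[n∸m]≡n (ℕ.≮⇒≥ t≮p)))
  ... | no t≮p  | no u≮q  | yes w<p =
    back (t ∸ (p + q)) w<p (sym (ℕ.m+[n∸m]≡n (n≤o∸m⇒m+n≤o (ℕ.≮⇒≥ t≮p) (ℕ.≮⇒≥ u≮q))))
  ... | no t≮p  | no u≮q  | no w≮p  =
    beyond (n≤o∸m⇒m+n≤o (n≤o∸m⇒m+n≤o (ℕ.≮⇒≥ t≮p) (ℕ.≮⇒≥ u≮q)) (ℕ.≮⇒≥ w≮p))

  private
    summand≤ : ∀ {a b t} → a + b ≡ t → a ≤ t
    summand≤ {a} {b} eq = ℕ.≤-trans (ℕ.m≤m+n a b) (ℕ.≤-reflexive eq)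

    p≤p+q : p ≤ p + q
    p≤p+q = ℕ.m≤m+n p q

    p+q≤L : p + q ≤ L
    p+q≤L = ℕ.m≤m+n (p + q) p

    p+u<p+q : ∀ {u} → u < q → p + u < p + q
    p+u<p+q = ℕ.+-monoʳ-< p

    p+q+u<L : ∀ {u} → u < p → p + q + u < L
    p+q+u<L = ℕ.+-monoʳ-< (p + q)

  position-unique : ∀ {t} (w w' : Position t) → w ≡ w'
  position-unique (along s s<p refl) (along _ s<p' refl) = cong (λ h → along s h refl) (ℕ.<-irrelevant s<p s<p')
  position-unique (along _ s<p refl) (around _ _ eq) = contradiction (summand≤ (sym eq)) (ℕ.<⇒≱ s<p)
  position-unique (along _ s<p refl) (back _ _ eq) =
    contradiction (ℕ.≤-trans p≤p+q (summand≤ (sym eq))) (ℕ.<⇒≱ s<p)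
  position-unique (along _ s<p refl) (beyond L≤s) =
    contradiction (ℕ.≤-trans (ℕ.≤-trans p≤p+q p+q≤L) L≤s) (ℕ.<⇒≱ s<p)
  position-unique (around u u<q refl) (around u' u'<q eq) with ℕ.+-cancelˡ-≡ p u u' eq
  ... | refl = cong₂ (λ h e → around u h e) (ℕ.<-irrelevant u<q u'<q) (ℕ.≡-irrelevant refl eq)
  position-unique (around _ _ refl) (along _ s<p eq) = contradiction (summand≤ eq) (ℕ.<⇒≱ s<p)
  position-unique (around _ u<q refl) (back _ _ eq) = contradiction (summand≤ (sym eq)) (ℕ.<⇒≱ (p+u<p+q u<q))
  position-unique (around _ u<q refl) (beyond L≤t) = contradiction (ℕ.≤-trans p+q≤L L≤t) (ℕ.<⇒≱ (p+u<p+q u<q))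
  position-unique (back u u<p refl) (back u' u'<p eq) with ℕ.+-cancelˡ-≡ (p + q) u u' eq
  ... | refl = cong₂ (λ h e → back u h e) (ℕ.<-irrelevant u<p u'<p) (ℕ.≡-irrelevant refl eq)
  position-unique (back _ _ refl) (along _ s<p eq) = contradiction (ℕ.≤-trans p≤p+q (summand≤ eq)) (ℕ.<⇒≱ s<p)
  position-unique (back _ _ refl) (around _ u<q eq) = contradiction (summand≤ eq) (ℕ.<⇒≱ (p+u<p+q u<q))
  position-unique (back _ u<p refl) (beyond L≤t) = contradiction L≤t (ℕ.<⇒≱ (p+q+u<L u<p))
  position-unique (beyond L≤t) (beyond L≤t') = cong beyond (ℕ.≤-irrelevant L≤t L≤t')
  position-unique (beyond L≤s) (along _ s<p refl) =
    contradiction (ℕ.≤-trans (ℕ.≤-trans p≤p+q p+q≤L) L≤s) (ℕ.<⇒≱ s<p)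
  position-unique (beyond L≤t) (around _ u<q refl) = contradiction (ℕ.≤-trans p+q≤L L≤t) (ℕ.<⇒≱ (p+u<p+q u<q))
  position-unique (beyond L≤t) (back _ u<p refl) = contradiction L≤t (ℕ.<⇒≱ (p+q+u<L u<p))

  stepAtPosition : ∀ {t} → Position t → Step tail head
  stepAtPosition (along s _ _)  = stepAt s
  stepAtPosition (around u _ _) = cycleStepAt u
  stepAtPosition (back u _ _)   = reverse (stepAt (p₀ ∸ u))
  stepAtPosition (beyond _)     = stepAt 0   -- never used: the walk has length L

  walkStep : ℕ → Step tail head
  walkStep t = stepAtPosition (position t)

  walkStep-along : ∀ {s} → s < p → walkStep s ≡ stepAt s
  walkStep-along {s} s<p = cong stepAtPosition (position-unique (position s) (along s s<p refl))

  walkStep-around : ∀ {u} → u < q → walkStep (p + u) ≡ cycleStepAt u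
  walkStep-around {u} u<q = cong stepAtPosition (position-unique (position (p + u)) (around u u<q refl))

  walkStep-back : ∀ {u} → u < p → walkStep (p + q + u) ≡ reverse (stepAt (p₀ ∸ u))
  walkStep-back {u} u<p = cong stepAtPosition (position-unique (position (p + q + u)) (back u u<p refl))

  p∸u≡1+[p₀∸u] : ∀ {u} → u < p → p ∸ u ≡ suc (p₀ ∸ u)
  p∸u≡1+[p₀∸u] u<p = ℕ.+-∸-assoc 1 (ℕ.s≤s⁻¹ u<p)

  start-walk-along : ∀ {s} → s ≤ p → stepStart (walkStep s) ≡ vertexAt s
  start-walk-along s≤p with ℕ.m≤n⇒m<n∨m≡n s≤p
  ... | inj₁ s<p  = trans (cong stepStart (walkStep-along s<p)) (start-stepAt s<p)
  ... | inj₂ refl = begin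
    stepStart (walkStep p)          ≡⟨ cong (stepStart ∘ walkStep) (sym (ℕ.+-identityʳ p)) ⟩
    stepStart (walkStep (p + 0))    ≡⟨ cong stepStart (walkStep-around (s≤s z≤n)) ⟩
    stepStart (cycleStepAt 0)       ≡⟨ start-cycleStepAt 0 ⟩
    Cycle.vert C (rotate k 0)       ≡⟨ cong (Cycle.vert C) (rotate-zero k) ⟩
    Cycle.vert C k                  ≡⟨ trans C-k (sym vertexAt-p) ⟩
    vertexAt p                      ∎
    where open ≡-Reasoning

  start-walk-around : ∀ {u} → u ≤ q → stepStart (walkStep (p + u)) ≡ cycleVertexAt u
  start-walk-around u≤q with ℕ.m≤n⇒m<n∨m≡n u≤q
  ... | inj₁ u<q  = trans (cong stepStart (walkStep-around u<q)) (start-cycleStepAt _)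
  ... | inj₂ refl = begin
    stepStart (walkStep (p + q))     ≡⟨ cong (stepStart ∘ walkStep) (sym (ℕ.+-identityʳ (p + q))) ⟩
    stepStart (walkStep (p + q + 0)) ≡⟨ cong stepStart (walkStep-back (s≤s z≤n)) ⟩
    stepStart (reverse (stepAt p₀))  ≡⟨ start-reverse tail head (stepAt p₀) ⟩
    stepEnd (stepAt p₀)              ≡⟨ end-stepAt ℕ.≤-refl ⟩
    vertexAt p                       ≡⟨ trans vertexAt-p (sym C-k) ⟩
    Cycle.vert C k                   ≡⟨ cong (Cycle.vert C) (rotate-period k) ⟨
    cycleVertexAt q                  ∎
    where open ≡-Reasoning

  start-walk-back : ∀ {u} → u < p → stepStart (walkStep (p + q + u)) ≡ vertexAt (p ∸ u)
  start-walk-back {u} u<p = begin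
    stepStart (walkStep (p + q + u))          ≡⟨ cong stepStart (walkStep-back u<p) ⟩
    stepStart (reverse (stepAt (p₀ ∸ u)))     ≡⟨ start-reverse tail head (stepAt (p₀ ∸ u)) ⟩
    stepEnd (stepAt (p₀ ∸ u))                 ≡⟨ end-stepAt (s≤s (ℕ.m∸n≤m p₀ u)) ⟩
    vertexAt (suc (p₀ ∸ u))                   ≡⟨ cong vertexAt (p∸u≡1+[p₀∸u] u<p) ⟨
    vertexAt (p ∸ u)                          ∎
    where open ≡-Reasoning

  walk-continuous : ∀ t → suc t < L → stepEnd (walkStep t) ≡ stepStart (walkStep (suc t))
  walk-continuous t t+1<L with position t
  ... | along s s<p refl = trans (end-stepAt s<p) (sym (start-walk-along s<p))
  ... | around u u<q refl = trans (end-cycleStepAt u)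
    (sym (trans (cong (stepStart ∘ walkStep) (sym (ℕ.+-suc p u))) (start-walk-around u<q)))
  ... | back u u<p refl =
    trans (end-reverse tail head (stepAt (p₀ ∸ u))) (trans (start-stepAt (s≤s (ℕ.m∸n≤m p₀ u)))
    (sym (trans (cong (stepStart ∘ walkStep) (sym (ℕ.+-suc (p + q) u))) (start-walk-back u+1<p))))
    where
    u+1<p : suc u < p
    u+1<p = ℕ.+-cancelˡ-< (p + q) (suc u) p (subst (_< L) (sym (ℕ.+-suc (p + q) u)) t+1<L)
  ... | beyond L≤t = contradiction (ℕ.≤-trans L≤t (ℕ.n≤1+n t)) (ℕ.<⇒≱ t+1<L)

  walk-closes : stepEnd (walkStep (p + q + p₀)) ≡ x
  walk-closes = begin
    stepEnd (walkStep (p + q + p₀))          ≡⟨ cong stepEnd (walkStep-back (ℕ.n<1+n p₀)) ⟩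
    stepEnd (reverse (stepAt (p₀ ∸ p₀)))     ≡⟨ end-reverse tail head (stepAt (p₀ ∸ p₀)) ⟩
    stepStart (stepAt (p₀ ∸ p₀))             ≡⟨ start-stepAt (s≤s (ℕ.m∸n≤m p₀ p₀)) ⟩
    vertexAt (p₀ ∸ p₀)                       ≡⟨ cong vertexAt (ℕ.n∸n≡0 p₀) ⟩
    vertexAt 0                               ≡⟨ P-start ⟩
    x                                        ∎
    where open ≡-Reasoning

  α : ℤ
  α = cycleVoltage G C

  level : ℕ → ℤ
  level zero    = 0ℤ
  level (suc t) = level t ℤ.+ stepVoltage G (walkStep t)

  level-+ : ∀ a u → level (a + u) ≡ level a ℤ.+ sumUpTo (λ i → stepVoltage G (walkStep (a + i))) u
  level-+ a zero    = trans (cong level (ℕ.+-identityʳ a)) (sym (ℤ.+-identityʳ (level a)))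
  level-+ a (suc u) = trans (cong level (ℕ.+-suc a u))
    (trans (cong (λ l → l ℤ.+ stepVoltage G (walkStep (a + u))) (level-+ a u)) (ℤ.+-assoc (level a) _ _))

  level-around : level (p + q) ≡ level p ℤ.+ α
  level-around = trans (level-+ p q) (cong (λ σ → level p ℤ.+ σ) (begin
    sumUpTo (λ i → stepVoltage G (walkStep (p + i))) q
      ≡⟨ sumUpTo-cong q (λ i i<q → cong (stepVoltage G) (walkStep-around i<q)) ⟩
    sumUpTo (λ i → stepVoltage G (cycleStepAt i)) q     ≡⟨ sumUpTo-rotate k (λ j → stepVoltage G (Cycle.step C j)) ⟩
    α                                                   ∎))
    where open ≡-Reasoning

  -- Going back along P undoes the voltages of the way out, so only the voltage of C remains.
  level-back : ∀ {u} → u ≤ p → level (p + q + u) ≡ α ℤ.+ level (p ∸ u)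
  level-back {zero}  _     = trans (cong level (ℕ.+-identityʳ (p + q))) (trans level-around (ℤ.+-comm (level p) α))
  level-back {suc u} u+1≤p = begin
    level (p + q + suc u)                                        ≡⟨ cong level (ℕ.+-suc (p + q) u) ⟩
    level (p + q + u) ℤ.+ stepVoltage G (walkStep (p + q + u))   ≡⟨ cong₂ ℤ._+_ (level-back (ℕ.<⇒≤ u+1≤p)) out-and-back ⟩
    (α ℤ.+ level (p ∸ u)) ℤ.+ - a                                ≡⟨ cong (λ l → (α ℤ.+ l) ℤ.+ - a) way-out ⟩
    (α ℤ.+ (level (p₀ ∸ u) ℤ.+ a)) ℤ.+ - a                       ≡⟨ lemma α (level (p₀ ∸ u)) a ⟩
    α ℤ.+ level (p₀ ∸ u)                                         ∎
    where
    open ≡-Reasoning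
    a = stepVoltage G (stepAt (p₀ ∸ u))
    way-out : level (p ∸ u) ≡ level (p₀ ∸ u) ℤ.+ a
    way-out = trans (cong level (p∸u≡1+[p₀∸u] u+1≤p))
      (cong (λ s → level (p₀ ∸ u) ℤ.+ stepVoltage G s) (walkStep-along (s≤s (ℕ.m∸n≤m p₀ u))))
    out-and-back : stepVoltage G (walkStep (p + q + u)) ≡ - a
    out-and-back = trans (cong (stepVoltage G) (walkStep-back u+1≤p)) (stepVoltage-reverse G (stepAt (p₀ ∸ u)))
    lemma : ∀ α l a → (α ℤ.+ (l ℤ.+ a)) ℤ.+ - a ≡ α ℤ.+ l
    lemma = solve-∀

  mirror : ∀ {u} → u ≤ p → reduce m (level (p ∸ u)) ≢ reduce m (level (p + q + u))
  mirror {u} u≤p eq = m∤α (∣⇒∣ᵤ (subst (+ m ∣ℤ_) (lemma α (level (p ∸ u)))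
    (subst (λ l → + m ∣ℤ l - level (p ∸ u)) (level-back u≤p)
      (reduce-injective m {level (p + q + u)} {level (p ∸ u)} (sym eq)))))
    where
    lemma : ∀ a l → (a ℤ.+ l) - l ≡ a
    lemma = solve-∀

  liftedStep : ℕ → Step dsrc dtgt
  liftedStep t = liftStep (level t) (walkStep t)

  liftedVertex : ℕ → DVert
  liftedVertex t = liftV (stepStart (walkStep t)) (reduce m (level t))

  end-liftedStep : ∀ {t} → suc t < L → end dsrc dtgt (liftedStep t) ≡ liftedVertex (suc t)
  end-liftedStep {t} t+1<L = trans (end-liftStep (level t) (walkStep t))
    (cong (λ w → liftV w (reduce m (level (suc t)))) (walk-continuous t t+1<L))

  end-liftedStep-last : end dsrc dtgt (liftedStep (p + q + p₀)) ≡ liftedVertex 0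
  end-liftedStep-last = begin
    end dsrc dtgt (liftedStep (p + q + p₀))      ≡⟨ end-liftStep (level (p + q + p₀)) (walkStep (p + q + p₀)) ⟩
    liftV (stepEnd (walkStep (p + q + p₀))) ℓ   ≡⟨ cong (λ w → liftV w ℓ) walk-closes ⟩
    liftV x ℓ                                   ≡⟨ liftV-pinned pinned-x ⟩
    pin x                                       ≡⟨ liftV-pinned pinned-x ⟨
    liftV x (reduce m 0ℤ)                       ≡⟨ cong (λ w → liftV w (reduce m 0ℤ)) x≡start ⟩
    liftedVertex 0                              ∎
    where
    open ≡-Reasoning
    ℓ = reduce m (level (suc (p + q + p₀)))
    x≡start : x ≡ stepStart (walkStep 0)
    x≡start = trans (sym P-start) (sym (start-walk-along z≤n))

  same-base : ∀ t t' → liftedVertex t ≡ liftedVertex t' → stepStart (walkStep t) ≡ stepStart (walkStep t')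
  same-base t t' = liftV-injectiveˡ

  same-level : ∀ t t' → pinned (stepStart (walkStep t)) ≡ false → liftedVertex t ≡ liftedVertex t' →
    reduce m (level t) ≡ reduce m (level t')
  same-level t t' unpinned eq =
    liftV-injectiveʳ unpinned (trans eq (cong (λ w → liftV w (reduce m (level t'))) (sym (same-base t t' eq))))

  along≢around : ∀ {s u} → s < p → u < q → liftedVertex s ≢ liftedVertex (p + u)
  along≢around {s} {u} s<p u<q eq = path-avoids-cycle u s<p
    (trans (sym (start-walk-along (ℕ.<⇒≤ s<p))) (trans (same-base s (p + u) eq) (start-walk-around (ℕ.<⇒≤ u<q))))

  along≢back : ∀ {s u} → s < p → u < p → liftedVertex s ≢ liftedVertex (p + q + u)
  along≢back {s} {u} s<p u<p eq = mirror (ℕ.<⇒≤ u<p) (subst (λ s → reduce m (level s) ≡ _) s≡p∸u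
    (same-level s (p + q + u) (subst (λ w → pinned w ≡ false) (sym (start-walk-along (ℕ.<⇒≤ s<p)))
      (path-interior-unpinned G P 0<s s<p)) eq))
    where
    s≡p∸u : s ≡ p ∸ u
    s≡p∸u = vertexAt-injective (ℕ.<⇒≤ s<p) (ℕ.m∸n≤m p u)
      (trans (sym (start-walk-along (ℕ.<⇒≤ s<p))) (trans (same-base s (p + q + u) eq) (start-walk-back u<p)))
    0<s : 0 < s
    0<s = subst (0 <_) (sym s≡p∸u) (ℕ.m<n⇒0<n∸m u<p)

  around≢back : ∀ {u u'} → u < q → u' < p → liftedVertex (p + u) ≢ liftedVertex (p + q + u')
  around≢back {u} {u'} u<q u'<p eq = mirror (ℕ.<⇒≤ u'<p)
    (trans (cong (reduce m ∘ level) p∸u'≡p+u) (same-level (p + u) (p + q + u') start-unpinned eq))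
    where
    start≡path : stepStart (walkStep (p + u)) ≡ vertexAt (p ∸ u')
    start≡path = trans (same-base (p + u) (p + q + u') eq) (start-walk-back u'<p)
    path-vertex≡v : vertexAt (p ∸ u') ≡ v
    path-vertex≡v = P∩C⊆v _ (rotate k u) (trans (sym start≡path) (start-walk-around (ℕ.<⇒≤ u<q)))
    start-unpinned : pinned (stepStart (walkStep (p + u))) ≡ false
    start-unpinned = subst (λ w → pinned w ≡ false) (sym (trans start≡path path-vertex≡v)) unpinned-v
    u≡0 : u ≡ 0
    u≡0 = cycleVertexAt≡v u<q (trans (sym (start-walk-around (ℕ.<⇒≤ u<q))) (trans start≡path path-vertex≡v))
    p∸u'≡p+u : p ∸ u' ≡ p + u
    p∸u'≡p+u = trans (vertexAt≡v (ℕ.m∸n≤m p u') path-vertex≡v)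
      (trans (sym (ℕ.+-identityʳ p)) (cong (λ i → p + i) (sym u≡0)))

  liftedVertex-injective : ∀ {t t'} → Position t → Position t' → t < L → t' < L →
    liftedVertex t ≡ liftedVertex t' → t ≡ t'
  liftedVertex-injective (along s s<p refl) (along s' s'<p refl) _ _ eq =
    vertexAt-injective (ℕ.<⇒≤ s<p) (ℕ.<⇒≤ s'<p)
      (trans (sym (start-walk-along (ℕ.<⇒≤ s<p))) (trans (same-base s s' eq) (start-walk-along (ℕ.<⇒≤ s'<p))))
  liftedVertex-injective (around u u<q refl) (around u' u'<q refl) _ _ eq =
    cong (λ i → p + i) (rotate-injective k u<q u'<q (Cycle.vert-inj C
      (trans (sym (start-walk-around (ℕ.<⇒≤ u<q)))
        (trans (same-base (p + u) (p + u') eq) (start-walk-around (ℕ.<⇒≤ u'<q))))))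
  liftedVertex-injective (back u u<p refl) (back u' u'<p refl) _ _ eq =
    cong (λ i → p + q + i) (ℕ.∸-cancelˡ-≡ (ℕ.<⇒≤ u<p) (ℕ.<⇒≤ u'<p)
      (vertexAt-injective (ℕ.m∸n≤m p u) (ℕ.m∸n≤m p u')
      (trans (sym (start-walk-back u<p)) (trans (same-base (p + q + u) (p + q + u') eq) (start-walk-back u'<p)))))
  liftedVertex-injective (along _ s<p refl) (around _ u<q refl) _ _ eq = contradiction eq (along≢around s<p u<q)
  liftedVertex-injective (around _ u<q refl) (along _ s<p refl) _ _ eq = contradiction (sym eq) (along≢around s<p u<q)
  liftedVertex-injective (along _ s<p refl) (back _ u<p refl) _ _ eq = contradiction eq (along≢back s<p u<p)
  liftedVertex-injective (back _ u<p refl) (along _ s<p refl) _ _ eq = contradiction (sym eq) (along≢back s<p u<p)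
  liftedVertex-injective (around _ u<q refl) (back _ u'<p refl) _ _ eq = contradiction eq (around≢back u<q u'<p)
  liftedVertex-injective (back _ u'<p refl) (around _ u<q refl) _ _ eq = contradiction (sym eq) (around≢back u<q u'<p)
  liftedVertex-injective (beyond L≤t) _ t<L _ _ = contradiction L≤t (ℕ.<⇒≱ t<L)
  liftedVertex-injective _ (beyond L≤t') _ t'<L _ = contradiction L≤t' (ℕ.<⇒≱ t'<L)

  liftedEdge : ℕ → DEdge
  liftedEdge t = proj₁ (liftedStep t)

  arc-of : ∀ t → proj (liftedEdge t) ≡ proj₁ (walkStep t)
  arc-of t = proj-liftStep (level t) (walkStep t)

  same-arc : ∀ t t' → liftedEdge t ≡ liftedEdge t' → proj₁ (walkStep t) ≡ proj₁ (walkStep t')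
  same-arc t t' eq = trans (sym (arc-of t)) (trans (cong proj eq) (arc-of t'))

  path-arc≢cycle-arc : ∀ {s} u → s < p → proj₁ (stepAt s) ≢ proj₁ (cycleStepAt u)
  path-arc≢cycle-arc {s} u s<p eq with same-edge-ends tail head (stepAt s) (cycleStepAt u) eq
  ... | inj₁ (starts , _) = path-avoids-cycle u s<p
    (trans (sym (start-stepAt s<p)) (trans starts (start-cycleStepAt u)))
  ... | inj₂ (start≡end , _) = path-avoids-cycle (suc u) s<p
    (trans (sym (start-stepAt s<p)) (trans start≡end (end-cycleStepAt u)))

  arc-along : ∀ {s} → s < p → proj₁ (walkStep s) ≡ proj₁ (stepAt s)
  arc-along s<p = cong proj₁ (walkStep-along s<p)

  arc-around : ∀ {u} → u < q → proj₁ (walkStep (p + u)) ≡ proj₁ (cycleStepAt u)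
  arc-around u<q = cong proj₁ (walkStep-around u<q)

  arc-back : ∀ {u} → u < p → proj₁ (walkStep (p + q + u)) ≡ proj₁ (stepAt (p₀ ∸ u))
  arc-back u<p = cong proj₁ (walkStep-back u<p)

  along≢back-edge : ∀ {s u} → s < p → u < p → liftedEdge s ≢ liftedEdge (p + q + u)
  along≢back-edge {s} {u} s<p u<p eq = mirror (ℕ.<⇒≤ u<p) (begin
    reduce m (level (p ∸ u))                          ≡⟨ cong (reduce m ∘ level) p∸u≡1+s ⟩
    reduce m (level (suc s))
      ≡⟨ cong (λ w → reduce m (level s ℤ.+ stepVoltage G w)) (walkStep-along s<p) ⟩
    reduce m (level s ℤ.+ stepVoltage G (stepAt s))
      ≡⟨ liftStep-reverse (level s) (level (p + q + u)) (stepAt s) same-lifted-edge ⟩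
    reduce m (level (p + q + u))                      ∎)
    where
    open ≡-Reasoning
    s≡p₀∸u : s ≡ p₀ ∸ u
    s≡p₀∸u = stepAt-injective s<p (s≤s (ℕ.m∸n≤m p₀ u))
      (trans (sym (arc-along s<p)) (trans (same-arc s (p + q + u) eq) (arc-back u<p)))
    p∸u≡1+s : p ∸ u ≡ suc s
    p∸u≡1+s = trans (p∸u≡1+[p₀∸u] u<p) (cong suc (sym s≡p₀∸u))
    back-step : walkStep (p + q + u) ≡ reverse (stepAt s)
    back-step = trans (walkStep-back u<p) (cong (reverse ∘ stepAt) (sym s≡p₀∸u))
    same-lifted-edge :
      proj₁ (liftStep (level s) (stepAt s)) ≡ proj₁ (liftStep (level (p + q + u)) (reverse (stepAt s)))
    same-lifted-edge = trans (cong (λ w → proj₁ (liftStep (level s) w)) (sym (walkStep-along s<p)))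
      (trans eq (cong (λ w → proj₁ (liftStep (level (p + q + u)) w)) back-step))

  liftedEdge-injective : ∀ {t t'} → Position t → Position t' → t < L → t' < L →
    liftedEdge t ≡ liftedEdge t' → t ≡ t'
  liftedEdge-injective (along s s<p refl) (along s' s'<p refl) _ _ eq =
    stepAt-injective s<p s'<p (trans (sym (arc-along s<p)) (trans (same-arc s s' eq) (arc-along s'<p)))
  liftedEdge-injective (around u u<q refl) (around u' u'<q refl) _ _ eq =
    cong (λ i → p + i) (rotate-injective k u<q u'<q (Cycle.edge-inj C
      (trans (sym (arc-around u<q)) (trans (same-arc (p + u) (p + u') eq) (arc-around u'<q)))))
  liftedEdge-injective (back u u<p refl) (back u' u'<p refl) _ _ eq =
    cong (λ i → p + q + i) (ℕ.∸-cancelˡ-≡ (ℕ.s≤s⁻¹ u<p) (ℕ.s≤s⁻¹ u'<p)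
      (stepAt-injective (s≤s (ℕ.m∸n≤m p₀ u)) (s≤s (ℕ.m∸n≤m p₀ u'))
        (trans (sym (arc-back u<p)) (trans (same-arc (p + q + u) (p + q + u') eq) (arc-back u'<p)))))
  liftedEdge-injective (along s s<p refl) (around u u<q refl) _ _ eq = contradiction
    (trans (sym (arc-along s<p)) (trans (same-arc s (p + u) eq) (arc-around u<q))) (path-arc≢cycle-arc u s<p)
  liftedEdge-injective (around u u<q refl) (along s s<p refl) _ _ eq = contradiction
    (trans (sym (arc-along s<p)) (trans (same-arc s (p + u) (sym eq)) (arc-around u<q))) (path-arc≢cycle-arc u s<p)
  liftedEdge-injective (back u' u'<p refl) (around u u<q refl) _ _ eq = contradiction
    (trans (sym (arc-back u'<p)) (trans (same-arc (p + q + u') (p + u) eq) (arc-around u<q)))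
    (path-arc≢cycle-arc u (s≤s (ℕ.m∸n≤m p₀ u')))
  liftedEdge-injective (around u u<q refl) (back u' u'<p refl) _ _ eq = contradiction
    (trans (sym (arc-back u'<p)) (trans (same-arc (p + q + u') (p + u) (sym eq)) (arc-around u<q)))
    (path-arc≢cycle-arc u (s≤s (ℕ.m∸n≤m p₀ u')))
  liftedEdge-injective (along _ s<p refl) (back _ u<p refl) _ _ eq = contradiction eq (along≢back-edge s<p u<p)
  liftedEdge-injective (back _ u<p refl) (along _ s<p refl) _ _ eq = contradiction (sym eq) (along≢back-edge s<p u<p)
  liftedEdge-injective (beyond L≤t) _ t<L _ _ = contradiction L≤t (ℕ.<⇒≱ t<L)
  liftedEdge-injective _ (beyond L≤t') _ t'<L _ = contradiction L≤t' (ℕ.<⇒≱ t'<L)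

  closes-up : ∀ t → suc t ≤ L → end dsrc dtgt (liftedStep t) ≡ liftedVertex (suc t % L)
  closes-up t t<L with ℕ.m≤n⇒m<n∨m≡n t<L
  ... | inj₁ t+1<L = trans (end-liftedStep t+1<L) (cong liftedVertex (sym (m<n⇒m%n≡m t+1<L)))
  ... | inj₂ t+1≡L = trans (cong (end dsrc dtgt ∘ liftedStep) t≡last)
    (trans end-liftedStep-last (cong liftedVertex (sym (trans (cong (_% L) t+1≡L) (n%n≡0 L)))))
    where
    t≡last : t ≡ p + q + p₀
    t≡last = ℕ.suc-injective (trans t+1≡L (ℕ.+-suc (p + q) p₀))

  liftedCycle : Cycle dsrc dtgt L
  liftedCycle = record
    { len-pos  = _
    ; vert     = λ j → liftedVertex (toℕ j)
    ; step     = λ j → liftedStep (toℕ j)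
    ; step-src = λ j → start-liftStep (level (toℕ j)) (walkStep (toℕ j))
    ; step-tgt = λ j → trans (closes-up (toℕ j) (Fin.toℕ<n j))
        (cong liftedVertex (sym (Fin.toℕ-fromℕ< (m%n<n (suc (toℕ j)) L))))
    ; vert-inj = λ {i} {j} eq → Fin.toℕ-injective
        (liftedVertex-injective (position (toℕ i)) (position (toℕ j)) (Fin.toℕ<n i) (Fin.toℕ<n j) eq)
    ; edge-inj = λ {i} {j} eq → Fin.toℕ-injective
        (liftedEdge-injective (position (toℕ i)) (position (toℕ j)) (Fin.toℕ<n i) (Fin.toℕ<n j) eq)
    }

  walkStep-in-H : ∀ t → InH G P C (proj₁ (walkStep t))
  walkStep-in-H t with position t
  ... | along s _ _  = inj₁ (clamp p₀ s , refl)
  ... | around u _ _ = inj₂ (rotate k u , refl)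
  ... | back u _ _   = inj₁ (clamp p₀ (p₀ ∸ u) , refl)
  ... | beyond _     = inj₁ (clamp p₀ 0 , refl)

  liftedCycle-lifts : LiftsTo G m P C liftedCycle
  liftedCycle-lifts = (λ j → subst (InH G P C) (sym (arc-of (toℕ j))) (walkStep-in-H (toℕ j))) , covers
    where
    arc-at : ∀ {t} (t<L : t < L) → proj (proj₁ (Cycle.step liftedCycle (fromℕ< t<L))) ≡ proj₁ (walkStep t)
    arc-at {t} t<L = trans (cong (λ t → proj (liftedEdge t)) (Fin.toℕ-fromℕ< t<L)) (arc-of t)
    covers : ∀ a → InH G P C a → ∃ λ j → proj (proj₁ (Cycle.step liftedCycle j)) ≡ a
    covers a (inj₁ (j , e)) = fromℕ< j<L , trans (arc-at j<L) (trans (arc-along (Fin.toℕ<n j))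
      (trans (cong (λ i → proj₁ (Path.step P i)) (clamp-unique (ℕ.s≤s⁻¹ (Fin.toℕ<n j)) refl)) e))
      where
      j<L : toℕ j < L
      j<L = ℕ.<-≤-trans (Fin.toℕ<n j) (ℕ.≤-trans p≤p+q p+q≤L)
    covers a (inj₂ (j , e)) = fromℕ< p+u<L , trans (arc-at p+u<L) (trans (arc-around u<q)
      (trans (cong (λ i → proj₁ (Cycle.step C i)) rotate-u≡j) e))
      where
      u : ℕ
      u = proj₁ (rotate-surjective k j)
      u<q : u < q
      u<q = proj₁ (proj₂ (rotate-surjective k j))
      rotate-u≡j : rotate k u ≡ j
      rotate-u≡j = proj₂ (proj₂ (rotate-surjective k j))
      p+u<L : p + u < L
      p+u<L = ℕ.<-≤-trans (p+u<p+q u<q) p+q≤L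

lemma3 : (G : VoltageGraph) (m : ℕ) .{{_ : NonZero m}} (p q : ℕ)
    (x v : Fin (VoltageGraph.nV G)) →
    VoltageGraph.pinned G x ≡ true → VoltageGraph.pinned G v ≡ false →
    (P : Path (VoltageGraph.tail G) (VoltageGraph.head G) p) →
    Path.vert P (Data.Fin.zero) ≡ x → Path.vert P (fromℕ p) ≡ v →
    (C : Cycle (VoltageGraph.tail G) (VoltageGraph.head G) q) →
    ∃ (λ k → Cycle.vert C k ≡ v) →
    (∀ j k → Path.vert P j ≡ Cycle.vert C k → Path.vert P j ≡ v) →
    ¬ ((+ m) ∣ cycleVoltage G C) →
    Σ (Cycle (Derived.dsrc G m) (Derived.dtgt G m) (2 * p + q)) (λ D → LiftsTo G m P C D)
lemma3 G m zero q x v pinned-x unpinned-v P P-start P-end C _ _ _ =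
  contradiction (trans (sym pinned-x) (trans (cong (VoltageGraph.pinned G) x≡v) unpinned-v)) λ ()
  where
  x≡v : x ≡ v
  x≡v = trans (sym P-start) P-end
lemma3 G m (suc p₀) zero x v pinned-x unpinned-v P P-start P-end C _ _ _ =
  ⊥-elim (NonZero.nonZero (Cycle.len-pos C))
lemma3 G m (suc p₀) (suc q₀) x v pinned-x unpinned-v P P-start P-end C (k , C-k) P∩C⊆v m∤α =
  subst (λ n → Σ (Cycle (Derived.dsrc G m) (Derived.dtgt G m) n) (LiftsTo G m P C))
    (p+q+p≡2p+q (suc p₀) (suc q₀)) (liftedCycle , liftedCycle-lifts)
  where
  open LiftedCycle G m p₀ q₀ pinned-x unpinned-v P P-start P-end C k C-k P∩C⊆v m∤α
  p+q+p≡2p+q : ∀ p q → p + q + p ≡ 2 * p + q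
  p+q+p≡2p+q = ℕ-solve-∀
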